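{- Let $\Gamma$ be a connected $3$-valent plane graph all of whose faces are $4$-gons or $6$-gons, and suppose $\Gamma$ is isometrically embeddable in a hypercube $H_m$. If the three faces meeting at some vertex of $\Gamma$ are all $4$-gons, then $\Gamma$ is the Cube graph.
   Context: $H_m$ is the graph on $\{0,1\}^m$ with Hamming distance; isometric embeddability means there is a distance-preserving map from the vertices of $\Gamma$ (with path distance) to $\{0,1\}^m$. -}

module Defs where

open import Data.Nat using (ℕ; zero; suc; _+_; _*_; _≤_; _<_; _≤ᵇ_; _<ᵇ_)
open import Data.Bool using (Bool; true; false; _∧_; if_then_else_)
open import Data.Fin using (Fin; toℕ) renaming (zero to fz; suc to fs)
open import Data.List using (List; length; filter; upTo; allFin; cartesianProductWith; map)
open import Data.Bool.ListAction using (and)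
open import Data.Vec using (Vec; []; _∷_)
open import Data.Product using (Σ; ∃; _×_; _,_; proj₁; proj₂)
open import Data.Sum using (_⊎_)
open import Relation.Binary.PropositionalEquality using (_≡_; _≢_)
open import Relation.Nullary using (¬_)
open import Relation.Nullary.Decidable using (Dec; yes; no)
open import Function.Bundles using (_⇔_)

-- A finite simple 3-valent graph on vertex set Fin n together with a
-- rotation system: the neighbours of v, in cyclic (clockwise) order,
-- are  nbr v 0 , nbr v 1 , nbr v 2 .  Every rotation system of a cubic
-- graph arises this way (choose the labelling of the three edges).
-- rev v i is the index of v in the neighbour list of nbr v i.

record CubicRot (n : ℕ) : Set where
  field
    nbr      : Fin n → Fin 3 → Fin n
    rev      : Fin n → Fin 3 → Fin 3
    rev-spec : ∀ v i → nbr (nbr v i) (rev v i) ≡ v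
    noLoop   : ∀ v i → nbr v i ≢ v
    nbr-inj  : ∀ v i j → nbr v i ≡ nbr v j → i ≡ j

open CubicRot public

-- darts (oriented edges): dart (v , i) leaves v along its i-th edge
Dart : ℕ → Set
Dart n = Fin n × Fin 3

next3 : Fin 3 → Fin 3
next3 fz = fs fz
next3 (fs fz) = fs (fs fz)
next3 (fs (fs fz)) = fz

α : ∀ {n} → CubicRot n → Dart n → Dart n
α G (v , i) = nbr G v i , rev G v i

-- face permutation: traverse the edge, then turn to the next edge in
-- the rotation at the arrival vertex
φ : ∀ {n} → CubicRot n → Dart n → Dart n
φ G (v , i) = nbr G v i , next3 (rev G v i)

iter : ∀ {A : Set} → (A → A) → ℕ → A → A
iter f zero x = x
iter f (suc k) x = f (iter f k x)

code : ∀ {n} → Dart n → ℕ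
code (v , i) = toℕ v * 3 + toℕ i

darts : ∀ n → List (Dart n)
darts n = cartesianProductWith _,_ (allFin n) (allFin 3)

-- a dart is the representative of its face if it has the least code
-- in its φ-orbit (orbits have at most 3n elements)
faceRep : ∀ {n} → CubicRot n → Dart n → Bool
faceRep {n} G x = and (map (λ j → code x ≤ᵇ code (iter (φ G) j x)) (upTo (3 * n)))

edgeRep : ∀ {n} → CubicRot n → Dart n → Bool
edgeRep G x = code x <ᵇ code (α G x)

numFaces : ∀ {n} → CubicRot n → ℕ
numFaces {n} G = length (filter (λ x → faceRep G x ≡? true) (darts n))
  where
  _≡?_ : (a b : Bool) → Dec (a ≡ b)
  true ≡? true = yes _≡_.refl
  false ≡? false = yes _≡_.refl
  true ≡? false = no (λ ())
  false ≡? true = no (λ ())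

numEdges : ∀ {n} → CubicRot n → ℕ
numEdges {n} G = length (filter (λ x → edgeRep G x ≡? true) (darts n))
  where
  _≡?_ : (a b : Bool) → Dec (a ≡ b)
  true ≡? true = yes _≡_.refl
  false ≡? false = yes _≡_.refl
  true ≡? false = no (λ ())
  false ≡? true = no (λ ())

-- the rotation system is a plane embedding (genus 0): V - E + F = 2
Planar : ∀ {n} → CubicRot n → Set
Planar {n} G = n + numFaces G ≡ numEdges G + 2

FaceSize : ∀ {n} → CubicRot n → Dart n → ℕ → Set
FaceSize G x k = (0 < k) × (iter (φ G) k x ≡ x)
               × (∀ j → 0 < j → j < k → iter (φ G) j x ≢ x)

Adj : ∀ {n} → CubicRot n → Fin n → Fin n → Set
Adj G u w = ∃ λ i → nbr G u i ≡ w

data Walk {n} (G : CubicRot n) : Fin n → Fin n → ℕ → Set where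
  here : ∀ u → Walk G u u 0
  step : ∀ {u w v k} → Adj G u w → Walk G w v k → Walk G u v (suc k)

Connected : ∀ {n} → CubicRot n → Set
Connected {n} G = ∀ (u v : Fin n) → ∃ λ k → Walk G u v k

Dist : ∀ {n} → CubicRot n → Fin n → Fin n → ℕ → Set
Dist G u v d = Walk G u v d × (∀ k → Walk G u v k → d ≤ k)

hamming : ∀ {m} → Vec Bool m → Vec Bool m → ℕ
hamming [] [] = 0
hamming (true ∷ xs) (false ∷ ys) = suc (hamming xs ys)
hamming (false ∷ xs) (true ∷ ys) = suc (hamming xs ys)
hamming (true ∷ xs) (true ∷ ys) = hamming xs ys
hamming (false ∷ xs) (false ∷ ys) = hamming xs ys

IsometricInHypercube : ∀ {n} → CubicRot n → Set
IsometricInHypercube {n} G =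
  ∃ λ (m : ℕ) → ∃ λ (f : Fin n → Vec Bool m) →
    ∀ u v → Dist G u v (hamming (f u) (f v))

IsCubeGraph : ∀ {n} → CubicRot n → Set
IsCubeGraph {n} G =
  Σ (Fin n → Vec Bool 3) λ f → Σ (Vec Bool 3 → Fin n) λ g →
    (∀ v → g (f v) ≡ v) × (∀ x → f (g x) ≡ x) ×
    (∀ u v → Adj G u v ⇔ (hamming (f u) (f v) ≡ 1))

module Submission where

-- Let v be the vertex whose three faces are squares, a i its neighbours, x i the corner opposite v of
-- the square through a i and a (prev3 i), and y i the third neighbour of x i.  In the hypercube
-- f (a i) = f v + e (k i), f (x i) = f (a i) + e (k (prev3 i)) and f (y i) = f (x i) + e (d i).
-- If some d i equals k (next3 i), the eight vertices v, a i, x i, y i fill a 3-dimensional subcube;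
-- each of them then has all three of its neighbours inside it, so by connectedness the graph is that
-- cube.  Otherwise f (y i) and f (y (next3 i)) differ in at least two coordinates, so the face through
-- y i, x i, a i, x (next3 i), y (next3 i) is a hexagon.  Its sixth vertex P i forces d (next3 i) = d i
-- and f (P i) = f v + e (k 0) + e (k 1) + e (k 2) + e (d i); hence all P i coincide, and y (next3 i)
-- would be joined to this single vertex by two different edges.

open import Defs
open import Data.Nat using (ℕ; suc; _+_; _≤_)
open import Data.Nat.Properties using (suc-injective; <-irrefl; ≤-antisym; n≢0⇒n>0; n≤0⇒n≡0; +-cancelˡ-≤)
open import Data.Fin using (Fin; zero; suc; punchOut)
open import Data.Fin.Properties using (_≟_; any?; punchOut-injective; injective⇒≤)
open import Data.Fin.Patterns using (0F; 1F; 2F)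
open import Data.Bool using (Bool; true; false; not; if_then_else_)
open import Data.Bool.Properties using (not-involutive; not-¬)
open import Data.Vec using (Vec; []; _∷_; lookup; updateAt)
open import Data.Vec.Properties
  using (lookup∘updateAt; lookup∘updateAt′; updateAt-updateAt; updateAt-id-local; updateAt-commutes)
open import Data.Vec.Relation.Unary.All using (All; []; _∷_)
open import Data.Vec.Relation.Unary.Unique.Propositional using (Unique; []; _∷_)
open import Data.Product using (∃; _,_; proj₁; proj₂)
open import Data.Sum using (_⊎_; inj₁; inj₂; [_,_]′) renaming (map to ⊎-map)
open import Data.Empty using (⊥; ⊥-elim)
open import Function.Definitions using (Injective)
open import Function using (_∘′_; id)
open import Function.Bundles using (_⇔_; mk⇔)
open import Relation.Nullary using (yes; no; contradiction)
open import Relation.Binary.PropositionalEquality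

private variable
  m : ℕ

toggle : Fin m → Vec Bool m → Vec Bool m
toggle k x = updateAt x k not

lookup-toggle : ∀ (k : Fin m) x → lookup (toggle k x) k ≡ not (lookup x k)
lookup-toggle k x = lookup∘updateAt k x

lookup-toggle-other : ∀ {j k : Fin m} x → j ≢ k → lookup (toggle k x) j ≡ lookup x j
lookup-toggle-other {j = j} {k} x j≢k = lookup∘updateAt′ j k j≢k x

toggle-involutive : ∀ (k : Fin m) x → toggle k (toggle k x) ≡ x
toggle-involutive k x = trans (updateAt-updateAt k x) (updateAt-id-local k x (not-involutive _))

toggle-comm : ∀ (j k : Fin m) x → toggle j (toggle k x) ≡ toggle k (toggle j x)
toggle-comm j k x with j ≟ k
... | yes refl = refl
... | no j≢k = updateAt-commutes j k j≢k x

toggle-rotate : ∀ (i j k : Fin m) x → toggle i (toggle j (toggle k x)) ≡ toggle k (toggle i (toggle j x))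
toggle-rotate i j k x = trans (cong (toggle i) (toggle-comm j k x)) (toggle-comm i k (toggle j x))

toggle-transpose : ∀ {k : Fin m} {x y} → y ≡ toggle k x → x ≡ toggle k y
toggle-transpose {k = k} {x} refl = sym (toggle-involutive k x)

toggle-injectiveˡ : ∀ {j k : Fin m} x → toggle j x ≡ toggle k x → j ≡ k
toggle-injectiveˡ {j = j} {k} x eq with j ≟ k
... | yes j≡k = j≡k
... | no j≢k = contradiction (sym not-xⱼ≡xⱼ) (not-¬ refl)
  where
  not-xⱼ≡xⱼ : not (lookup x j) ≡ lookup x j
  not-xⱼ≡xⱼ = trans (sym (lookup-toggle j x)) (trans (cong (λ t → lookup t j) eq) (lookup-toggle-other x j≢k))

lookup-toggle-both-other : ∀ {j q q′ : Fin m} x → j ≢ q → j ≢ q′ →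
                           lookup (toggle q x) j ≡ lookup (toggle q′ x) j
lookup-toggle-both-other x j≢q j≢q′ = trans (lookup-toggle-other x j≢q) (sym (lookup-toggle-other x j≢q′))

-- Vertices at distance two have only two common neighbours: w (c ≡ a) and the opposite corner (c ≡ b).
toggle-square : ∀ {a b c c′ : Fin m} w → a ≢ b →
                toggle c (toggle a w) ≡ toggle c′ (toggle b w) → c ≡ b ⊎ c ≡ a
toggle-square {a = a} {b} {c} {c′} w a≢b eq with c ≟ b | c ≟ a
... | yes c≡b | _       = inj₁ c≡b
... | no _    | yes c≡a = inj₂ c≡a
... | no c≢b  | no c≢a with c′ ≟ a
...   | yes refl = contradiction (trans (sym lhs) (trans (cong (λ t → lookup t b) eq) rhs)) (not-¬ refl)
  where
  lhs : lookup (toggle c (toggle a w)) b ≡ lookup w b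
  lhs = trans (lookup-toggle-other (toggle a w) (c≢b ∘′ sym)) (lookup-toggle-other w (a≢b ∘′ sym))
  rhs : lookup (toggle a (toggle b w)) b ≡ not (lookup w b)
  rhs = trans (lookup-toggle-other (toggle b w) (a≢b ∘′ sym)) (lookup-toggle b w)
...   | no c′≢a = contradiction (trans (sym rhs) (trans (cong (λ t → lookup t a) (sym eq)) lhs)) (not-¬ refl)
  where
  lhs : lookup (toggle c (toggle a w)) a ≡ not (lookup w a)
  lhs = trans (lookup-toggle-other (toggle a w) (c≢a ∘′ sym)) (lookup-toggle a w)
  rhs : lookup (toggle c′ (toggle b w)) a ≡ lookup w a
  rhs = trans (lookup-toggle-other (toggle b w) (c′≢a ∘′ sym)) (lookup-toggle-other w a≢b)

hamming-refl : ∀ (x : Vec Bool m) → hamming x x ≡ 0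
hamming-refl []          = refl
hamming-refl (true ∷ x)  = hamming-refl x
hamming-refl (false ∷ x) = hamming-refl x

hamming-sym : ∀ (x y : Vec Bool m) → hamming x y ≡ hamming y x
hamming-sym []          []          = refl
hamming-sym (true ∷ x)  (true ∷ y)  = hamming-sym x y
hamming-sym (true ∷ x)  (false ∷ y) = cong suc (hamming-sym x y)
hamming-sym (false ∷ x) (true ∷ y)  = cong suc (hamming-sym x y)
hamming-sym (false ∷ x) (false ∷ y) = hamming-sym x y

hamming≡0⇒≡ : ∀ (x y : Vec Bool m) → hamming x y ≡ 0 → x ≡ y
hamming≡0⇒≡ []          []          _  = refl
hamming≡0⇒≡ (true ∷ x)  (true ∷ y)  eq = cong (true ∷_) (hamming≡0⇒≡ x y eq)
hamming≡0⇒≡ (false ∷ x) (false ∷ y) eq = cong (false ∷_) (hamming≡0⇒≡ x y eq)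

hamming≡1⇒toggle : ∀ (x y : Vec Bool m) → hamming x y ≡ 1 → ∃ λ k → y ≡ toggle k x
hamming≡1⇒toggle []          []          ()
hamming≡1⇒toggle (true ∷ x)  (false ∷ y) eq =
  zero , cong (false ∷_) (sym (hamming≡0⇒≡ x y (suc-injective eq)))
hamming≡1⇒toggle (false ∷ x) (true ∷ y)  eq = zero , cong (true ∷_) (sym (hamming≡0⇒≡ x y (suc-injective eq)))
hamming≡1⇒toggle (true ∷ x)  (true ∷ y)  eq with k , y≡ ← hamming≡1⇒toggle x y eq = suc k , cong (true ∷_) y≡
hamming≡1⇒toggle (false ∷ x) (false ∷ y) eq with k , y≡ ← hamming≡1⇒toggle x y eq = suc k , cong (false ∷_) y≡

hamming-cons : ∀ b c (x y : Vec Bool m) → hamming (b ∷ x) (c ∷ y) ≡ hamming (b ∷ []) (c ∷ []) + hamming x y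
hamming-cons true  true  x y = refl
hamming-cons true  false x y = refl
hamming-cons false true  x y = refl
hamming-cons false false x y = refl

hamming-toggleˡ : ∀ (k : Fin m) x y → lookup x k ≡ lookup y k → hamming (toggle k x) y ≡ suc (hamming x y)
hamming-toggleˡ zero    (true ∷ x)  (true ∷ y)  _  = refl
hamming-toggleˡ zero    (false ∷ x) (false ∷ y) _  = refl
hamming-toggleˡ (suc k) (true ∷ x)  (true ∷ y)  eq = hamming-toggleˡ k x y eq
hamming-toggleˡ (suc k) (true ∷ x)  (false ∷ y) eq = cong suc (hamming-toggleˡ k x y eq)
hamming-toggleˡ (suc k) (false ∷ x) (true ∷ y)  eq = cong suc (hamming-toggleˡ k x y eq)
hamming-toggleˡ (suc k) (false ∷ x) (false ∷ y) eq = hamming-toggleˡ k x y eq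

hamming-toggleʳ : ∀ (k : Fin m) x y → lookup x k ≡ lookup y k → hamming x (toggle k y) ≡ suc (hamming x y)
hamming-toggleʳ k x y eq = begin
  hamming x (toggle k y)  ≡⟨ hamming-sym x (toggle k y) ⟩
  hamming (toggle k y) x  ≡⟨ hamming-toggleˡ k y x (sym eq) ⟩
  suc (hamming y x)       ≡⟨ cong suc (hamming-sym y x) ⟩
  suc (hamming x y)       ∎
  where open ≡-Reasoning

hamming-toggle-toggle : ∀ (k : Fin m) x y → hamming (toggle k x) (toggle k y) ≡ hamming x y
hamming-toggle-toggle zero    (true ∷ x)  (true ∷ y)  = refl
hamming-toggle-toggle zero    (true ∷ x)  (false ∷ y) = refl
hamming-toggle-toggle zero    (false ∷ x) (true ∷ y)  = refl
hamming-toggle-toggle zero    (false ∷ x) (false ∷ y) = refl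
hamming-toggle-toggle (suc k) (true ∷ x)  (true ∷ y)  = hamming-toggle-toggle k x y
hamming-toggle-toggle (suc k) (true ∷ x)  (false ∷ y) = cong suc (hamming-toggle-toggle k x y)
hamming-toggle-toggle (suc k) (false ∷ x) (true ∷ y)  = cong suc (hamming-toggle-toggle k x y)
hamming-toggle-toggle (suc k) (false ∷ x) (false ∷ y) = hamming-toggle-toggle k x y

hamming-toggle : ∀ (k : Fin m) x → hamming x (toggle k x) ≡ 1
hamming-toggle k x = trans (hamming-toggleʳ k x x refl) (cong suc (hamming-refl x))

hamming-toggle₂ : ∀ {j k : Fin m} x y → j ≢ k → lookup x j ≡ lookup y j → lookup x k ≡ lookup y k →
                  hamming (toggle j x) (toggle k y) ≡ 2 + hamming x y
hamming-toggle₂ {j = j} {k} x y j≢k xⱼ≡yⱼ xₖ≡yₖ =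
  trans (hamming-toggleˡ j x (toggle k y) (trans xⱼ≡yⱼ (sym (lookup-toggle-other y j≢k))))
        (cong suc (hamming-toggleʳ k x y xₖ≡yₖ))

toggleIf : Bool → Fin m → Vec Bool m → Vec Bool m
toggleIf b k x = if b then toggle k x else x

lookup-toggleIf-other : ∀ b {j k : Fin m} x → j ≢ k → lookup (toggleIf b k x) j ≡ lookup x j
lookup-toggleIf-other true  x j≢k = lookup-toggle-other x j≢k
lookup-toggleIf-other false x j≢k = refl

hamming-toggleIf : ∀ b c (k : Fin m) x y → lookup x k ≡ lookup y k →
                   hamming (toggleIf b k x) (toggleIf c k y) ≡ hamming (b ∷ []) (c ∷ []) + hamming x y
hamming-toggleIf true  true  k x y _  = hamming-toggle-toggle k x y
hamming-toggleIf true  false k x y eq = hamming-toggleˡ k x y eq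
hamming-toggleIf false true  k x y eq = hamming-toggleʳ k x y eq
hamming-toggleIf false false k x y _  = refl

subcube : ∀ {d} → Vec (Fin m) d → Vec Bool m → Vec Bool d → Vec Bool m
subcube []      z []      = z
subcube (k ∷ κ) z (b ∷ bs) = toggleIf b k (subcube κ z bs)

lookup-subcube-outside : ∀ {d} {k : Fin m} (κ : Vec (Fin m) d) z bs → All (k ≢_) κ →
                         lookup (subcube κ z bs) k ≡ lookup z k
lookup-subcube-outside []       z []       []           = refl
lookup-subcube-outside (k′ ∷ κ) z (b ∷ bs) (k≢k′ ∷ k∉κ) =
  trans (lookup-toggleIf-other b (subcube κ z bs) k≢k′) (lookup-subcube-outside κ z bs k∉κ)

hamming-subcube : ∀ {d} {κ : Vec (Fin m) d} → Unique κ → ∀ z bs cs →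
                  hamming (subcube κ z bs) (subcube κ z cs) ≡ hamming bs cs
hamming-subcube {κ = []}    []            z []       []       = hamming-refl z
hamming-subcube {κ = k ∷ κ} (k∉κ ∷ uniq) z (b ∷ bs) (c ∷ cs) = begin
  hamming (toggleIf b k (subcube κ z bs)) (toggleIf c k (subcube κ z cs))
    ≡⟨ hamming-toggleIf b c k _ _
         (trans (lookup-subcube-outside κ z bs k∉κ) (sym (lookup-subcube-outside κ z cs k∉κ))) ⟩
  hamming (b ∷ []) (c ∷ []) + hamming (subcube κ z bs) (subcube κ z cs)
    ≡⟨ cong (hamming (b ∷ []) (c ∷ []) +_) (hamming-subcube uniq z bs cs) ⟩
  hamming (b ∷ []) (c ∷ []) + hamming bs cs
    ≡⟨ sym (hamming-cons b c bs cs) ⟩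
  hamming (b ∷ bs) (c ∷ cs) ∎
  where open ≡-Reasoning

injective⇒surjective : ∀ {n} {h : Fin n → Fin n} → Injective _≡_ _≡_ h → ∀ c → ∃ λ j → h j ≡ c
injective⇒surjective {suc n} {h} h-inj c with any? (λ j → h j ≟ c)
... | yes hit  = hit
... | no  miss = contradiction (injective⇒≤ squeezed-injective) (<-irrefl refl)
  where
  squeezed : Fin (suc n) → Fin n
  squeezed j = punchOut {i = c} (λ c≡hj → miss (j , sym c≡hj))
  squeezed-injective : Injective _≡_ _≡_ squeezed
  squeezed-injective eq = h-inj (punchOut-injective {i = c} _ _ eq)

prev3 : Fin 3 → Fin 3
prev3 i = next3 (next3 i)

next3-prev3 : ∀ i → next3 (prev3 i) ≡ i
next3-prev3 0F = refl
next3-prev3 1F = refl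
next3-prev3 2F = refl

prev3-next3 : ∀ i → prev3 (next3 i) ≡ i
prev3-next3 0F = refl
prev3-next3 1F = refl
prev3-next3 2F = refl

next3≢id : ∀ i → next3 i ≢ i
next3≢id 0F ()
next3≢id 1F ()
next3≢id 2F ()

prev3≢id : ∀ i → prev3 i ≢ i
prev3≢id 0F ()
prev3≢id 1F ()
prev3≢id 2F ()

prev3≢next3 : ∀ i → prev3 i ≢ next3 i
prev3≢next3 0F ()
prev3≢next3 1F ()
prev3≢next3 2F ()

Fin3-rotations : ∀ r c → c ≡ r ⊎ c ≡ next3 r ⊎ c ≡ prev3 r
Fin3-rotations 0F 0F = inj₁ refl
Fin3-rotations 0F 1F = inj₂ (inj₁ refl)
Fin3-rotations 0F 2F = inj₂ (inj₂ refl)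
Fin3-rotations 1F 0F = inj₂ (inj₂ refl)
Fin3-rotations 1F 1F = inj₁ refl
Fin3-rotations 1F 2F = inj₂ (inj₁ refl)
Fin3-rotations 2F 0F = inj₂ (inj₁ refl)
Fin3-rotations 2F 1F = inj₂ (inj₂ refl)
Fin3-rotations 2F 2F = inj₁ refl

turn : ∀ {n} → Dart n → Dart n
turn (v , i) = v , next3 i

φ⁻¹ : ∀ {n} → CubicRot n → Dart n → Dart n
φ⁻¹ G (v , i) = α G (v , prev3 i)

α-involutive : ∀ {n} (G : CubicRot n) x → α G (α G x) ≡ x
α-involutive G (v , i) = cong₂ _,_ (rev-spec G v i) (nbr-inj G v _ i back)
  where
  w = nbr G v i
  back : nbr G v (rev G w (rev G v i)) ≡ w
  back = subst (λ u → nbr G u (rev G w (rev G v i)) ≡ w) (rev-spec G v i) (rev-spec G w (rev G v i))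

φ∘α : ∀ {n} (G : CubicRot n) x → φ G (α G x) ≡ turn x
φ∘α G (v , i) = cong turn (α-involutive G (v , i))

φ⁻¹∘φ : ∀ {n} (G : CubicRot n) x → φ⁻¹ G (φ G x) ≡ x
φ⁻¹∘φ G (v , i) = trans (cong (λ j → α G (nbr G v i , j)) (prev3-next3 (rev G v i))) (α-involutive G (v , i))

φ∘φ⁻¹ : ∀ {n} (G : CubicRot n) x → φ G (φ⁻¹ G x) ≡ x
φ∘φ⁻¹ G (v , i) = trans (φ∘α G (v , prev3 i)) (cong (v ,_) (next3-prev3 i))

square-diagonal : ∀ {n} (G : CubicRot n) {x} → FaceSize G x 4 → φ⁻¹ G (φ⁻¹ G x) ≡ φ G (φ G x)
square-diagonal G {x} (_ , φ⁴x≡x , _) = begin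
  φ⁻¹ G (φ⁻¹ G x)                               ≡⟨ cong (φ⁻¹ G ∘′ φ⁻¹ G) (sym φ⁴x≡x) ⟩
  φ⁻¹ G (φ⁻¹ G (φ G (φ G (φ G (φ G x)))))       ≡⟨ cong (φ⁻¹ G) (φ⁻¹∘φ G _) ⟩
  φ⁻¹ G (φ G (φ G (φ G x)))                     ≡⟨ φ⁻¹∘φ G _ ⟩
  φ G (φ G x)                                   ∎
  where open ≡-Reasoning

Walk-0 : ∀ {n} {G : CubicRot n} {u w} → Walk G u w 0 → u ≡ w
Walk-0 (here _) = refl

Walk-1 : ∀ {n} {G : CubicRot n} {u w} → Walk G u w 1 → Adj G u w
Walk-1 (step adj (here _)) = adj

module Isometry {n m} (G : CubicRot n) (f : Fin n → Vec Bool m)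
                (iso : ∀ u w → Dist G u w (hamming (f u) (f w))) where

  hamming-≤-walk : ∀ {u w ℓ} → Walk G u w ℓ → hamming (f u) (f w) ≤ ℓ
  hamming-≤-walk {u} {w} p = proj₂ (iso u w) _ p

  f-injective : ∀ {u w} → f u ≡ f w → u ≡ w
  f-injective {u} {w} eq = Walk-0 (subst (Walk G u w) hamming≡0 (proj₁ (iso u w)))
    where
    hamming≡0 : hamming (f u) (f w) ≡ 0
    hamming≡0 = trans (cong (hamming (f u)) (sym eq)) (hamming-refl (f u))

  Adj⇒hamming≡1 : ∀ {u w} → Adj G u w → hamming (f u) (f w) ≡ 1
  Adj⇒hamming≡1 {u} {w} (c , e) = ≤-antisym (hamming-≤-walk (step (c , e) (here w))) (n≢0⇒n>0 hamming≢0)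
    where
    hamming≢0 : hamming (f u) (f w) ≢ 0
    hamming≢0 h≡0 = noLoop G u c (trans e (sym (f-injective (hamming≡0⇒≡ _ _ h≡0))))

  hamming≡1⇒Adj : ∀ {u w} → hamming (f u) (f w) ≡ 1 → Adj G u w
  hamming≡1⇒Adj {u} {w} h≡1 = Walk-1 (subst (Walk G u w) h≡1 (proj₁ (iso u w)))

  edge-toggles : ∀ u c → ∃ λ q → f (nbr G u c) ≡ toggle q (f u)
  edge-toggles u c = hamming≡1⇒toggle _ _ (Adj⇒hamming≡1 (c , refl))

  edge-coordinate-injective : ∀ {u c c′ q} →
                              f (nbr G u c) ≡ toggle q (f u) → f (nbr G u c′) ≡ toggle q (f u) → c ≡ c′
  edge-coordinate-injective {u} eq eq′ = nbr-inj G u _ _ (f-injective (trans eq (sym eq′)))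

module Subcube {n m} (G : CubicRot n) (connected : Connected G) (f : Fin n → Vec Bool m)
               (iso : ∀ u w → Dist G u w (hamming (f u) (f w)))
               {κ : Vec (Fin m) 3} (κ-unique : Unique κ) (z : Vec Bool m)
               (g : Vec Bool 3 → Fin n) (f∘g : ∀ b → f (g b) ≡ subcube κ z b) where

  open Isometry G f iso

  hamming-g : ∀ b b′ → hamming (f (g b)) (f (g b′)) ≡ hamming b b′
  hamming-g b b′ = trans (cong₂ hamming (f∘g b) (f∘g b′)) (hamming-subcube κ-unique z b b′)

  g-injective : ∀ {b b′} → g b ≡ g b′ → b ≡ b′
  g-injective {b} {b′} eq = hamming≡0⇒≡ b b′ (begin
    hamming b b′               ≡⟨ sym (hamming-g b b′) ⟩
    hamming (f (g b)) (f (g b′)) ≡⟨ cong (λ u → hamming (f (g b)) (f u)) (sym eq) ⟩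
    hamming (f (g b)) (f (g b))  ≡⟨ hamming-refl (f (g b)) ⟩
    0                          ∎)
    where open ≡-Reasoning

  InImage : Fin n → Set
  InImage u = ∃ λ b → g b ≡ u

  edge-to-neighbour : ∀ b j → Adj G (g b) (g (toggle j b))
  edge-to-neighbour b j = hamming≡1⇒Adj (trans (hamming-g b (toggle j b)) (hamming-toggle j b))

  edge-to-neighbour-injective : ∀ b → Injective _≡_ _≡_ (λ j → proj₁ (edge-to-neighbour b j))
  edge-to-neighbour-injective b {j} {j′} eq = toggle-injectiveˡ b (g-injective
    (trans (sym (proj₂ (edge-to-neighbour b j))) (trans (cong (nbr G (g b)) eq) (proj₂ (edge-to-neighbour b j′)))))

  -- The edges towards the three neighbours of b in the subcube use up all three darts at g b.
  neighbour-in-image : ∀ b c → InImage (nbr G (g b) c)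
  neighbour-in-image b c with j , eⱼ≡c ← injective⇒surjective (edge-to-neighbour-injective b) c =
    toggle j b , trans (sym (proj₂ (edge-to-neighbour b j))) (cong (nbr G (g b)) eⱼ≡c)

  walk-in-image : ∀ {u w ℓ} → InImage u → Walk G u w ℓ → InImage w
  walk-in-image u∈g (here _)                 = u∈g
  walk-in-image (b , refl) (step (c , refl) p) = walk-in-image (neighbour-in-image b c) p

  all-in-image : ∀ u → InImage u
  all-in-image u = walk-in-image (b₀ , refl) (proj₂ (connected (g b₀) u))
    where
    b₀ = false ∷ false ∷ false ∷ []

  isCubeGraph : IsCubeGraph G
  isCubeGraph = label , g , (λ u → proj₂ (all-in-image u)) , (λ b → g-injective (proj₂ (all-in-image (g b))))
              , adjacency
    where
    label : Fin n → Vec Bool 3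
    label u = proj₁ (all-in-image u)
    hamming-label : ∀ u u′ → hamming (f u) (f u′) ≡ hamming (label u) (label u′)
    hamming-label u u′ =
      trans (sym (cong₂ (λ p q → hamming (f p) (f q)) (proj₂ (all-in-image u)) (proj₂ (all-in-image u′))))
            (hamming-g (label u) (label u′))
    adjacency : ∀ u u′ → Adj G u u′ ⇔ (hamming (label u) (label u′) ≡ 1)
    adjacency u u′ = mk⇔ (λ adj → trans (sym (hamming-label u u′)) (Adj⇒hamming≡1 adj))
                         (λ h≡1 → hamming≡1⇒Adj (trans (hamming-label u u′) h≡1))

-- x i is the corner opposite v of the square through the dart (v , i); its neighbours are a i (via s i),
-- a (prev3 i) and y i.  The face of the dart E i runs y i, x i, a i, x (next3 i), y (next3 i), P i.
module ThreeSquares {n} (G : CubicRot n) (v : Fin n) (squares : ∀ i → FaceSize G (v , i) 4) where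

  a : Fin 3 → Fin n
  a i = nbr G v i

  r : Fin 3 → Fin 3
  r i = rev G v i

  x : Fin 3 → Fin n
  x i = nbr G (a i) (next3 (r i))

  s : Fin 3 → Fin 3
  s i = rev G (a i) (next3 (r i))

  y : Fin 3 → Fin n
  y i = nbr G (x i) (prev3 (s i))

  σ : Fin 3 → Fin 3
  σ i = rev G (x i) (prev3 (s i))

  E : Fin 3 → Dart n
  E i = y i , σ i

  P : Fin 3 → Fin n
  P i = nbr G (y (next3 i)) (next3 (σ (next3 i)))

  x≢v : ∀ i → x i ≢ v
  x≢v i x≡v = next3≢id (r i) (nbr-inj G (a i) _ _ (trans x≡v (sym (rev-spec G v i))))

  square-closes : ∀ i → α G (x i , next3 (s i)) ≡ (a (prev3 i) , prev3 (r (prev3 i)))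
  square-closes i = trans (cong (α G) (sym (square-diagonal G (squares i)))) (α-involutive G _)

  x-adj-a-prev : ∀ i → nbr G (x i) (next3 (s i)) ≡ a (prev3 i)
  x-adj-a-prev i = cong proj₁ (square-closes i)

  a-third-edge : ∀ i → α G (a i , prev3 (r i)) ≡ (x (next3 i) , next3 (s (next3 i)))
  a-third-edge i = subst (λ j → α G (a j , prev3 (r j)) ≡ (x (next3 i) , next3 (s (next3 i))))
                         (prev3-next3 i) (square-diagonal G (squares (next3 i)))

  a-neighbours : ∀ i c → nbr G (a i) c ≡ v ⊎ nbr G (a i) c ≡ x i ⊎ nbr G (a i) c ≡ x (next3 i)
  a-neighbours i c with Fin3-rotations (r i) c
  ... | inj₁ refl        = inj₁ (rev-spec G v i)
  ... | inj₂ (inj₁ refl) = inj₂ (inj₁ refl)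
  ... | inj₂ (inj₂ refl) = inj₂ (inj₂ (cong proj₁ (a-third-edge i)))

  E-walk : ∀ i → iter (φ G) 4 (E i) ≡ (y (next3 i) , next3 (σ (next3 i)))
  E-walk i = begin
    φ G (φ G (φ G (φ G (E i))))              ≡⟨ cong (φ G ∘′ φ G ∘′ φ G) (φ∘φ⁻¹ G (x i , s i)) ⟩
    φ G (φ G (φ G (x i , s i)))              ≡⟨ cong (φ G ∘′ φ G) (φ∘α G (a i , next3 (r i))) ⟩
    φ G (φ G (a i , prev3 (r i)))            ≡⟨ cong (φ G ∘′ turn) (a-third-edge i) ⟩
    φ G (x (next3 i) , prev3 (s (next3 i)))  ∎
    where open ≡-Reasoning

  E-square : ∀ i → FaceSize G (E i) 4 → y (next3 i) ≡ y i
  E-square i (_ , φ⁴E≡E , _) = cong proj₁ (trans (sym (E-walk i)) φ⁴E≡E)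

  E-hexagon : ∀ i → FaceSize G (E i) 6 → nbr G (y i) (prev3 (σ i)) ≡ P i
  E-hexagon i (_ , φ⁶E≡E , _) = cong proj₁ (begin
    φ⁻¹ G (E i)                                ≡⟨ cong (φ⁻¹ G) (sym φ⁶E≡E) ⟩
    φ⁻¹ G (φ G (φ G (iter (φ G) 4 (E i))))     ≡⟨ φ⁻¹∘φ G _ ⟩
    φ G (iter (φ G) 4 (E i))                   ≡⟨ cong (φ G) (E-walk i) ⟩
    φ G (y (next3 i) , next3 (σ (next3 i)))    ∎)
    where open ≡-Reasoning

module Embedding {n m} (G : CubicRot n) (connected : Connected G)
                 (faces : ∀ (e : Dart n) → FaceSize G e 4 ⊎ FaceSize G e 6)
                 (f : Fin n → Vec Bool m) (iso : ∀ u w → Dist G u w (hamming (f u) (f w)))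
                 (v : Fin n) (squares : ∀ i → FaceSize G (v , i) 4) where

  open Isometry G f iso
  open ThreeSquares G v squares

  z : Vec Bool m
  z = f v

  k : Fin 3 → Fin m
  k i = proj₁ (edge-toggles v i)

  f-a : ∀ i → f (a i) ≡ toggle (k i) z
  f-a i = proj₂ (edge-toggles v i)

  k-distinct : ∀ {i j} → i ≢ j → k i ≢ k j
  k-distinct {i} {j} i≢j kᵢ≡kⱼ =
    i≢j (edge-coordinate-injective (f-a i) (subst (λ q → f (a j) ≡ toggle q z) (sym kᵢ≡kⱼ) (f-a j)))

  -- f (x i) is a common neighbour of f (a i) and f (a (prev3 i)) other than f v.
  f-x : ∀ i → f (x i) ≡ toggle (k (prev3 i)) (f (a i))
  f-x i = [ (λ c≡kₚ → trans via-a (cong (λ q → toggle q (f (a i))) c≡kₚ)) , ⊥-elim ∘′ c≢kᵢ ]′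
            (toggle-square z (k-distinct (prev3≢id i ∘′ sym)) two-ways)
    where
    c  = proj₁ (edge-toggles (a i) (next3 (r i)))
    c′ = proj₁ (edge-toggles (x i) (next3 (s i)))
    via-a : f (x i) ≡ toggle c (f (a i))
    via-a = proj₂ (edge-toggles (a i) (next3 (r i)))
    via-a-prev : f (x i) ≡ toggle c′ (f (a (prev3 i)))
    via-a-prev =
      toggle-transpose (trans (cong f (sym (x-adj-a-prev i))) (proj₂ (edge-toggles (x i) (next3 (s i)))))
    two-ways : toggle c (toggle (k i) z) ≡ toggle c′ (toggle (k (prev3 i)) z)
    two-ways = trans (sym (trans via-a (cong (toggle c) (f-a i))))
                     (trans via-a-prev (cong (toggle c′) (f-a (prev3 i))))
    c≢kᵢ : c ≢ k i
    c≢kᵢ c≡kᵢ = x≢v i (f-injective (begin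
      f (x i)                        ≡⟨ via-a ⟩
      toggle c (f (a i))             ≡⟨ cong₂ toggle c≡kᵢ (f-a i) ⟩
      toggle (k i) (toggle (k i) z)  ≡⟨ toggle-involutive (k i) z ⟩
      z                              ∎))
      where open ≡-Reasoning

  f-x-next : ∀ i → f (x (next3 i)) ≡ toggle (k (next3 i)) (f (a i))
  f-x-next i = begin
    f (x (next3 i))                                 ≡⟨ f-x (next3 i) ⟩
    toggle (k (prev3 (next3 i))) (f (a (next3 i)))  ≡⟨ cong₂ toggle (cong k (prev3-next3 i)) (f-a (next3 i)) ⟩
    toggle (k i) (toggle (k (next3 i)) z)           ≡⟨ toggle-comm (k i) (k (next3 i)) z ⟩
    toggle (k (next3 i)) (toggle (k i) z)           ≡⟨ cong (toggle (k (next3 i))) (sym (f-a i)) ⟩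
    toggle (k (next3 i)) (f (a i))                  ∎
    where open ≡-Reasoning

  x-to-a : ∀ i → f (nbr G (x i) (s i)) ≡ toggle (k (prev3 i)) (f (x i))
  x-to-a i = trans (cong f (rev-spec G (a i) (next3 (r i)))) (toggle-transpose (f-x i))

  x-to-a-prev : ∀ i → f (nbr G (x i) (next3 (s i))) ≡ toggle (k i) (f (x i))
  x-to-a-prev i = begin
    f (nbr G (x i) (next3 (s i)))                         ≡⟨ cong f (x-adj-a-prev i) ⟩
    f (a (prev3 i))                                       ≡⟨ f-a (prev3 i) ⟩
    toggle kₚ z                                           ≡⟨ sym (toggle-involutive (k i) _) ⟩
    toggle (k i) (toggle (k i) (toggle kₚ z))             ≡⟨ cong (toggle (k i)) (toggle-comm (k i) kₚ z) ⟩
    toggle (k i) (toggle kₚ (toggle (k i) z))             ≡⟨ cong (toggle (k i) ∘′ toggle kₚ) (sym (f-a i)) ⟩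
    toggle (k i) (toggle kₚ (f (a i)))                    ≡⟨ cong (toggle (k i)) (sym (f-x i)) ⟩
    toggle (k i) (f (x i))                                ∎
    where
    open ≡-Reasoning
    kₚ = k (prev3 i)

  d : Fin 3 → Fin m
  d i = proj₁ (edge-toggles (x i) (prev3 (s i)))

  f-y : ∀ i → f (y i) ≡ toggle (d i) (f (x i))
  f-y i = proj₂ (edge-toggles (x i) (prev3 (s i)))

  d≢kₚ : ∀ i → d i ≢ k (prev3 i)
  d≢kₚ i d≡kₚ =
    prev3≢id (s i) (edge-coordinate-injective (f-y i) (subst (λ q → _ ≡ toggle q _) (sym d≡kₚ) (x-to-a i)))

  d≢kᵢ : ∀ i → d i ≢ k i
  d≢kᵢ i d≡kᵢ = prev3≢next3 (s i)
    (edge-coordinate-injective (f-y i) (subst (λ q → _ ≡ toggle q _) (sym d≡kᵢ) (x-to-a-prev i)))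

  a-edge-coordinates : ∀ i {u q} → f u ≡ toggle q (f (a i)) → q ≡ k i ⊎ q ≡ k (prev3 i) ⊎ q ≡ k (next3 i)
  a-edge-coordinates i {u} {q} f-u =
    ⊎-map (λ a→v → same-toggle a→v (toggle-transpose (f-a i)))
          (⊎-map (λ a→x → same-toggle a→x (f-x i)) (λ a→x → same-toggle a→x (f-x-next i)))
          (a-neighbours i (proj₁ a-u))
    where
    a-u : Adj G (a i) u
    a-u = hamming≡1⇒Adj (trans (cong (hamming (f (a i))) f-u) (hamming-toggle q (f (a i))))
    same-toggle : ∀ {w q′} → nbr G (a i) (proj₁ a-u) ≡ w → f w ≡ toggle q′ (f (a i)) → q ≡ q′
    same-toggle a→w f-w =
      toggle-injectiveˡ (f (a i)) (trans (sym f-u) (trans (cong f (trans (sym (proj₂ a-u)) a→w)) f-w))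

  κ : Vec (Fin m) 3
  κ = k 0F ∷ k 1F ∷ k 2F ∷ []

  κ-unique : Unique κ
  κ-unique = (k-distinct (λ ()) ∷ k-distinct (λ ()) ∷ []) ∷ (k-distinct (λ ()) ∷ []) ∷ [] ∷ []

  corner : Vec Bool m
  corner = subcube κ z (true ∷ true ∷ true ∷ [])

  corner-from : ∀ i → toggle (k (next3 i)) (toggle (k (prev3 i)) (toggle (k i) z)) ≡ corner
  corner-from 0F = toggle-rotate (k 1F) (k 2F) (k 0F) z
  corner-from 1F = trans (toggle-rotate (k 2F) (k 0F) (k 1F) z) (toggle-rotate (k 1F) (k 2F) (k 0F) z)
  corner-from 2F = refl

  f-y-corner : ∀ i → d i ≡ k (next3 i) → f (y i) ≡ corner
  f-y-corner i d≡kₙ = begin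
    f (y i)                                                       ≡⟨ f-y i ⟩
    toggle (d i) (f (x i))                                        ≡⟨ cong₂ toggle d≡kₙ (f-x i) ⟩
    toggle (k (next3 i)) (toggle (k (prev3 i)) (f (a i)))         ≡⟨ cong (toggle _ ∘′ toggle _) (f-a i) ⟩
    toggle (k (next3 i)) (toggle (k (prev3 i)) (toggle (k i) z))  ≡⟨ corner-from i ⟩
    corner                                                        ∎
    where open ≡-Reasoning

  module CubeCase {w : Fin n} (f-w : f w ≡ corner) where

    g : Vec Bool 3 → Fin n
    g (false ∷ false ∷ false ∷ []) = v
    g (true  ∷ false ∷ false ∷ []) = a 0F
    g (false ∷ true  ∷ false ∷ []) = a 1F
    g (false ∷ false ∷ true  ∷ []) = a 2F
    g (true  ∷ true  ∷ false ∷ []) = x 1F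
    g (true  ∷ false ∷ true  ∷ []) = x 0F
    g (false ∷ true  ∷ true  ∷ []) = x 2F
    g (true  ∷ true  ∷ true  ∷ []) = w

    f∘g : ∀ b → f (g b) ≡ subcube κ z b
    f∘g (false ∷ false ∷ false ∷ []) = refl
    f∘g (true  ∷ false ∷ false ∷ []) = f-a 0F
    f∘g (false ∷ true  ∷ false ∷ []) = f-a 1F
    f∘g (false ∷ false ∷ true  ∷ []) = f-a 2F
    f∘g (true  ∷ true  ∷ false ∷ []) = trans (f-x 1F) (cong (toggle (k 0F)) (f-a 1F))
    f∘g (true  ∷ false ∷ true  ∷ []) = trans (f-x-next 2F) (cong (toggle (k 0F)) (f-a 2F))
    f∘g (false ∷ true  ∷ true  ∷ []) = trans (f-x 2F) (cong (toggle (k 1F)) (f-a 2F))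
    f∘g (true  ∷ true  ∷ true  ∷ []) = f-w

    open Subcube G connected f iso κ-unique z g f∘g public using (isCubeGraph)

  module NoCorner (d≢kₙ : ∀ i → d i ≢ k (next3 i)) where

    f-y-via-a : ∀ i → f (y i) ≡ toggle (k (prev3 i)) (toggle (d i) (f (a i)))
    f-y-via-a i = trans (f-y i) (trans (cong (toggle (d i)) (f-x i)) (toggle-comm (d i) _ (f (a i))))

    f-y-next-via-a : ∀ i → f (y (next3 i)) ≡ toggle (k (next3 i)) (toggle (d (next3 i)) (f (a i)))
    f-y-next-via-a i = trans (f-y (next3 i))
      (trans (cong (toggle (d (next3 i))) (f-x-next i)) (toggle-comm (d (next3 i)) _ (f (a i))))

    y-gap : ∀ i → hamming (f (y i)) (f (y (next3 i)))
                  ≡ 2 + hamming (toggle (d i) (f (a i))) (toggle (d (next3 i)) (f (a i)))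
    y-gap i = trans (cong₂ hamming (f-y-via-a i) (f-y-next-via-a i))
      (hamming-toggle₂ (toggle (d i) (f (a i))) (toggle (d (next3 i)) (f (a i))) (k-distinct (prev3≢next3 i))
         (lookup-toggle-both-other (f (a i)) (d≢kₚ i ∘′ sym) (d≢kₙ (next3 i) ∘′ sym))
         (lookup-toggle-both-other (f (a i)) (d≢kₙ i ∘′ sym) (d≢kᵢ (next3 i) ∘′ sym)))

    E-hexagonal : ∀ i → FaceSize G (E i) 6
    E-hexagonal i = [ (λ square → ⊥-elim (y-apart (E-square i square))) , id ]′ (faces (E i))
      where
      y-apart : y (next3 i) ≢ y i
      y-apart yₙ≡y = contradiction (trans (sym (y-gap i)) hamming≡0) λ ()
        where
        hamming≡0 : hamming (f (y i)) (f (y (next3 i))) ≡ 0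
        hamming≡0 = trans (cong (λ u → hamming (f (y i)) (f u)) yₙ≡y) (hamming-refl (f (y i)))

    d-next : ∀ i → d (next3 i) ≡ d i
    d-next i = sym (toggle-injectiveˡ (f (a i)) (hamming≡0⇒≡ _ _ (n≤0⇒n≡0 (+-cancelˡ-≤ 2 _ 0 gap≤2))))
      where
      y-P-y : Walk G (y i) (y (next3 i)) 2
      y-P-y = step (_ , E-hexagon i (E-hexagonal i))
                   (step (_ , rev-spec G (y (next3 i)) (next3 (σ (next3 i)))) (here _))
      gap≤2 : 2 + hamming (toggle (d i) (f (a i))) (toggle (d (next3 i)) (f (a i))) ≤ 2
      gap≤2 = subst (_≤ 2) (y-gap i) (hamming-≤-walk y-P-y)

    P-coordinates : ∀ i → f (P i) ≡ toggle (k (prev3 i)) (toggle (k (next3 i)) (toggle (d i) (f (a i))))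
    P-coordinates i = [ (λ q≡kₚ → trans via-yₙ (cong (λ t → toggle t (toggle (k (next3 i)) W)) q≡kₚ))
                      , ⊥-elim ∘′ q≢kₙ ]′
                      (toggle-square W (k-distinct (prev3≢next3 i ∘′ sym)) two-ways)
      where
      W = toggle (d i) (f (a i))
      q  = proj₁ (edge-toggles (y (next3 i)) (next3 (σ (next3 i))))
      q′ = proj₁ (edge-toggles (y i) (prev3 (σ i)))
      f-yₙ : f (y (next3 i)) ≡ toggle (k (next3 i)) W
      f-yₙ = trans (f-y-next-via-a i) (cong (λ t → toggle (k (next3 i)) (toggle t (f (a i)))) (d-next i))
      via-yₙ : f (P i) ≡ toggle q (toggle (k (next3 i)) W)
      via-yₙ = trans (proj₂ (edge-toggles (y (next3 i)) (next3 (σ (next3 i))))) (cong (toggle q) f-yₙ)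
      via-y : f (P i) ≡ toggle q′ (toggle (k (prev3 i)) W)
      via-y = trans (cong f (sym (E-hexagon i (E-hexagonal i))))
                    (trans (proj₂ (edge-toggles (y i) (prev3 (σ i)))) (cong (toggle q′) (f-y-via-a i)))
      two-ways : toggle q (toggle (k (next3 i)) W) ≡ toggle q′ (toggle (k (prev3 i)) W)
      two-ways = trans (sym via-yₙ) via-y
      q≢kₙ : q ≢ k (next3 i)
      q≢kₙ q≡kₙ = [ d≢kᵢ i , [ d≢kₚ i , d≢kₙ i ]′ ]′ (a-edge-coordinates i P-at-W)
        where
        P-at-W : f (P i) ≡ W
        P-at-W = trans via-yₙ (trans (cong (λ t → toggle t (toggle (k (next3 i)) W)) q≡kₙ)
                                     (toggle-involutive (k (next3 i)) W))

    f-P : ∀ i → f (P i) ≡ toggle (d i) corner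
    f-P i = begin
      f (P i)                                                ≡⟨ P-coordinates i ⟩
      toggle kₚ (toggle kₙ (toggle (d i) (f (a i))))         ≡⟨ toggle-rotate kₚ kₙ (d i) (f (a i)) ⟩
      toggle (d i) (toggle kₚ (toggle kₙ (f (a i))))         ≡⟨ cong (toggle (d i)) (toggle-comm kₚ kₙ (f (a i))) ⟩
      toggle (d i) (toggle kₙ (toggle kₚ (f (a i))))         ≡⟨ cong (toggle (d i) ∘′ toggle kₙ ∘′ toggle kₚ) (f-a i) ⟩
      toggle (d i) (toggle kₙ (toggle kₚ (toggle (k i) z)))  ≡⟨ cong (toggle (d i)) (corner-from i) ⟩
      toggle (d i) corner                                    ∎
      where
      open ≡-Reasoning
      kₚ = k (prev3 i)
      kₙ = k (next3 i)

    -- y 1F would reach the single vertex P 0F = P 1F along two different darts.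
    absurd : ⊥
    absurd = prev3≢next3 (σ 1F) (nbr-inj G (y 1F) _ _ (trans (E-hexagon 1F (E-hexagonal 1F)) P₁≡P₀))
      where
      P₁≡P₀ : P 1F ≡ P 0F
      P₁≡P₀ = f-injective (trans (f-P 1F) (trans (cong (λ t → toggle t corner) (d-next 0F)) (sym (f-P 0F))))

  isCubeGraph : IsCubeGraph G
  isCubeGraph with any? (λ i → d i ≟ k (next3 i))
  ... | yes (i , d≡kₙ) = CubeCase.isCubeGraph (f-y-corner i d≡kₙ)
  ... | no  no-corner  = ⊥-elim (NoCorner.absurd (λ i d≡kₙ → no-corner (i , d≡kₙ)))

lemma8 : ∀ (n : ℕ) (G : CubicRot n) → Connected G → Planar G
       → (∀ (x : Dart n) → FaceSize G x 4 ⊎ FaceSize G x 6)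
       → IsometricInHypercube G
       → (∃ λ (v : Fin n) → ∀ i → FaceSize G (v , i) 4)
       → IsCubeGraph G
lemma8 n G connected _ faces (m , f , iso) (v , squares) =
  Embedding.isCubeGraph G connected faces f iso v squares
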